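{- Let $\ell \ge 1$ be an integer and let $S = \mathrm{Build}(2^{\ell})$ be the sequence of binary strings defined recursively by $\mathrm{Build}(2^1) = (00, 01)$ and, for $\ell \ge 2$, if $\mathrm{Build}(2^{\ell-1}) = (s_1, \ldots, s_{2^{\ell-1}})$ then $\mathrm{Build}(2^{\ell}) = (s_1 \circ s_1,\ s_1 \circ \overline{s_1},\ s_2 \circ s_2,\ s_2\circ\overline{s_2},\ \ldots,\ s_{2^{\ell-1}} \circ s_{2^{\ell-1}},\ s_{2^{\ell-1}} \circ \overline{s_{2^{\ell-1}}})$. Then $S$ consists of $2^\ell$ strings of length $2^\ell$, and for each two distinct positions $i, j \in \{1, \ldots, 2^{\ell}\}$ the following hold: (1) there are $|S|/2$ strings $a$ in $S$ with $a[i] = a[j]$; (2) there are $|S|/2$ strings $b$ in $S$ with $b[i] \neq b[j]$.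
   Context: For binary strings $s, s'$, $s \circ s'$ denotes their concatenation, $\overline{s}$ denotes the bitwise complement of $s$, and $s[i]$ denotes the $i$-th bit of $s$. Strings in $S$ are counted with multiplicity (as entries of the sequence). -}

module Defs where

open import Data.Bool using (Bool; true; false; not)
open import Data.Nat using (ℕ; zero; suc)
open import Data.List using (List; []; _∷_; _++_; map; concatMap)

-- Binary strings are lists of booleans (false = 0, true = 1).
BitString : Set
BitString = List Bool

complement : BitString → BitString
complement = map not

-- Build(2^ℓ), indexed by ℓ.  Build(2^1) = (00, 01);
-- Build(2^(ℓ+1)) replaces each s by s∘s, s∘complement s (in order).
-- The value at ℓ = 0 is never used by the statement (which assumes ℓ ≥ 1).
build : ℕ → List BitString
build zero = []
build (suc zero) = (false ∷ false ∷ []) ∷ (false ∷ true ∷ []) ∷ []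
build (suc (suc k)) = concatMap (λ s → (s ++ s) ∷ (s ++ complement s) ∷ []) (build (suc k))

-- s[i], 0-indexed; default false out of range (only used in range in the statement).
bitAt : BitString → ℕ → Bool
bitAt [] _ = false
bitAt (b ∷ _) zero = b
bitAt (_ ∷ s) (suc i) = bitAt s i

-- Write A_{i,j}(L) and D_{i,j}(L) for the numbers of strings a in L with
-- a[i] = a[j], resp. a[i] ≠ a[j]; always A + D = |L|.  Build(2^(ℓ+1)) is the
-- "doubling" of L = Build(2^ℓ): every s (of length n = 2^ℓ) is replaced by
-- s∘s and s∘s̄.  A position p < 2n of a doubled string is either p' or n + p'
-- with p' < n; in s∘s it reads s[p'], in s∘s̄ it reads s[p'] or ¬s[p'].
-- Hence, counting the s∘s and the s∘s̄ strings separately,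
--   * if p, q lie in the same half,  A_{p,q}(doubling L) = A_{p',q'} + A_{p',q'};
--   * if they lie in different halves, A_{p,q}(doubling L) = A_{p',q'} + D_{p',q'} = |L|.
-- In both cases 2·A = |doubling L| follows (by induction in the first case,
-- where p' ≠ q'), and then 2·D = |L| from A + D = |L|.
module Submission where

open import Defs
open import Data.Empty using (⊥-elim)
open import Data.Bool using (Bool; true; false; not)
open import Data.Bool.Properties using (_≟_)
open import Data.Nat using (ℕ; zero; suc; _^_; _*_; _+_; _<_; _≤_; s≤s; _<?_)
open import Data.Nat.Properties
  using (+-suc; +-identityʳ; +-cancelˡ-≡; *-distribˡ-+; m+[n∸m]≡n; m<n+o⇒m∸n<o; ≮⇒≥)
open import Data.List using (List; []; _∷_; _++_; map; length; filter; concatMap)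
open import Data.List.Properties using (length-++; length-map)
open import Data.List.Relation.Unary.All as All using (All; []; _∷_)
open import Data.Product using (_×_; _,_)
open import Function using (_∘_)
open import Level using (0ℓ)
open import Relation.Binary.PropositionalEquality
  using (_≡_; _≢_; refl; sym; trans; cong; cong₂; subst; module ≡-Reasoning)
open import Relation.Nullary using (Dec; does; yes; no; ¬?)
open import Relation.Unary using (Pred; Decidable)

open ≡-Reasoning

count : {A : Set} {P : Pred A 0ℓ} → Decidable P → List A → ℕ
count P? L = length (filter P? L)

count-¬ : {A : Set} {P : Pred A 0ℓ} (P? : Decidable P) (L : List A) →
          count P? L + count (¬? ∘ P?) L ≡ length L
count-¬ P? [] = refl
count-¬ P? (a ∷ L) with does (P? a)
... | true  = cong suc (count-¬ P? L)
... | false = trans (+-suc (count P? L) _) (cong suc (count-¬ P? L))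

count-map : {A B : Set} (f : A → B) {P : Pred B 0ℓ} {Q : Pred A 0ℓ}
            (P? : Decidable P) (Q? : Decidable Q) (L : List A) →
            All (λ a → does (P? (f a)) ≡ does (Q? a)) L →
            count P? (map f L) ≡ count Q? L
count-map f P? Q? [] [] = refl
count-map f P? Q? (a ∷ L) (same ∷ sames) with does (P? (f a)) | does (Q? a)
count-map f P? Q? (a ∷ L) (refl ∷ sames) | true  | true  = cong suc (count-map f P? Q? L sames)
count-map f P? Q? (a ∷ L) (refl ∷ sames) | false | false = count-map f P? Q? L sames

count-interleave : {A B : Set} (f g : A → B) {P : Pred B 0ℓ} (P? : Decidable P) (L : List A) →
                   count P? (concatMap (λ a → f a ∷ g a ∷ []) L)
                     ≡ count P? (map f L) + count P? (map g L)
count-interleave f g P? [] = refl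
count-interleave f g P? (a ∷ L) with does (P? (f a))
... | true  with does (P? (g a))
...   | true  = cong suc (trans (cong suc ih) (sym (+-suc _ _))) where ih = count-interleave f g P? L
...   | false = cong suc (count-interleave f g P? L)
count-interleave f g P? (a ∷ L) | false with does (P? (g a))
...   | true  = trans (cong suc ih) (sym (+-suc _ _)) where ih = count-interleave f g P? L
...   | false = count-interleave f g P? L

bitAt-++ˡ : ∀ s t {i} → i < length s → bitAt (s ++ t) i ≡ bitAt s i
bitAt-++ˡ (b ∷ s) t {zero}  _         = refl
bitAt-++ˡ (b ∷ s) t {suc i} (s≤s i<n) = bitAt-++ˡ s t i<n

bitAt-++ʳ : ∀ s t {n} i → length s ≡ n → bitAt (s ++ t) (n + i) ≡ bitAt t i
bitAt-++ʳ []      t i refl = refl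
bitAt-++ʳ (b ∷ s) t i refl = bitAt-++ʳ s t i refl

bitAt-complement : ∀ s {i} → i < length s → bitAt (complement s) i ≡ not (bitAt s i)
bitAt-complement (b ∷ s) {zero}  _         = refl
bitAt-complement (b ∷ s) {suc i} (s≤s i<n) = bitAt-complement s i<n

data Half (n : ℕ) : ℕ → Set where
  low  : ∀ {i} → i < n → Half n i
  high : ∀ {i} → i < n → Half n (n + i)

half : ∀ n i → i < 2 * n → Half n i
half zero    i ()
half (suc m) i i<2n with i <? suc m
... | yes i<n = low i<n
... | no  i≮n = subst (Half (suc m)) (m+[n∸m]≡n (≮⇒≥ i≮n)) (high (m<n+o⇒m∸n<o i (suc m) i<n+n))
  where
  i<n+n : i < suc m + suc m
  i<n+n = subst (i <_) (cong (suc m +_) (+-identityʳ _)) i<2n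

offset : ∀ {n i} → Half n i → ℕ
offset (low  {i} _) = i
offset (high {i} _) = i

offset< : ∀ {n i} (h : Half n i) → offset h < n
offset< (low  i<n) = i<n
offset< (high i<n) = i<n

-- the second copy in s ∘ s̄ reads the complemented bit
flipIn : ∀ {n i} → Half n i → Bool → Bool
flipIn (low  _) b = b
flipIn (high _) b = not b

dup dupc : BitString → BitString
dup  s = s ++ s
dupc s = s ++ complement s

doubling : List BitString → List BitString
doubling = concatMap (λ s → dup s ∷ dupc s ∷ [])

bitAt-dup : ∀ {n} s {i} → length s ≡ n → (h : Half n i) → bitAt (dup s) i ≡ bitAt s (offset h)
bitAt-dup s refl (low  i<n) = bitAt-++ˡ s s i<n
bitAt-dup s refl (high {i} _) = bitAt-++ʳ s s i refl

bitAt-dupc : ∀ {n} s {i} → length s ≡ n → (h : Half n i) →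
             bitAt (dupc s) i ≡ flipIn h (bitAt s (offset h))
bitAt-dupc s refl (low  i<n) = bitAt-++ˡ s (complement s) i<n
bitAt-dupc s refl (high {i} i<n) = trans (bitAt-++ʳ s (complement s) i refl) (bitAt-complement s i<n)

length-doubling : ∀ L → length (doubling L) ≡ length L + length L
length-doubling []      = refl
length-doubling (s ∷ L) = cong suc (trans (cong suc (length-doubling L)) (sym (+-suc _ _)))

length-++-halves : ∀ (s t : BitString) {n} → length s ≡ n → length t ≡ n → length (s ++ t) ≡ 2 * n
length-++-halves s t {n} refl t≡n = trans (length-++ s) (cong (n +_) (trans t≡n (sym (+-identityʳ n))))

all-length-doubling : ∀ {n} L → All (λ s → length s ≡ n) L → All (λ s → length s ≡ 2 * n) (doubling L)
all-length-doubling []      []            = []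
all-length-doubling (s ∷ L) (refl ∷ lens) =
  length-++-halves s s refl refl ∷ length-++-halves s (complement s) refl (length-map not s)
  ∷ all-length-doubling L lens

size-build : ∀ k → length (build (suc k)) ≡ 2 ^ suc k
size-build zero    = refl
size-build (suc k) = begin
  length (doubling (build (suc k)))             ≡⟨ length-doubling (build (suc k)) ⟩
  length (build (suc k)) + length (build (suc k)) ≡⟨ cong (λ m → m + m) (size-build k) ⟩
  2 ^ suc k + 2 ^ suc k                          ≡⟨ cong (2 ^ suc k +_) (sym (+-identityʳ _)) ⟩
  2 ^ suc (suc k)                                ∎

lengths-build : ∀ k → All (λ s → length s ≡ 2 ^ suc k) (build (suc k))
lengths-build zero    = refl ∷ refl ∷ []
lengths-build (suc k) = all-length-doubling (build (suc k)) (lengths-build k)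

agreements disagreements : ℕ → ℕ → List BitString → ℕ
agreements    i j = count (λ a → bitAt a i ≟ bitAt a j)
disagreements i j = count (λ a → ¬? (bitAt a i ≟ bitAt a j))

Balanced : ℕ → ℕ → List BitString → Set
Balanced i j L = 2 * agreements i j L ≡ length L

twice : ∀ m → 2 * m ≡ m + m
twice m = cong (m +_) (+-identityʳ m)

-- a balanced pair also has exactly half disagreements, since A + D = |L|
disagreements-balanced : ∀ i j L → Balanced i j L → 2 * disagreements i j L ≡ length L
disagreements-balanced i j L bal = +-cancelˡ-≡ (length L) _ _ (begin
  length L + 2 * D    ≡⟨ cong (_+ 2 * D) (sym bal) ⟩
  2 * A + 2 * D       ≡⟨ sym (*-distribˡ-+ 2 A D) ⟩
  2 * (A + D)         ≡⟨ cong (2 *_) (count-¬ (λ a → bitAt a i ≟ bitAt a j) L) ⟩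
  2 * length L        ≡⟨ twice (length L) ⟩
  length L + length L ∎)
  where
  A D : ℕ
  A = agreements i j L
  D = disagreements i j L

≟-not-not : ∀ x y → does (not x ≟ not y) ≡ does (x ≟ y)
≟-not-not false false = refl
≟-not-not false true  = refl
≟-not-not true  false = refl
≟-not-not true  true  = refl

≟-notʳ : ∀ x y → does (x ≟ not y) ≡ does (¬? (x ≟ y))
≟-notʳ false false = refl
≟-notʳ false true  = refl
≟-notʳ true  false = refl
≟-notʳ true  true  = refl

≟-notˡ : ∀ x y → does (not x ≟ y) ≡ does (¬? (x ≟ y))
≟-notˡ false false = refl
≟-notˡ false true  = refl
≟-notˡ true  false = refl
≟-notˡ true  true  = refl

module Doubling {n : ℕ} (L : List BitString) (lens : All (λ s → length s ≡ n) L)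
                {p q : ℕ} (hp : Half n p) (hq : Half n q) where

  p' q' : ℕ
  p' = offset hp
  q' = offset hq

  agreements-dup : agreements p q (map dup L) ≡ agreements p' q' L
  agreements-dup = count-map dup _ _ L (All.map (λ {s} → same s) lens)
    where
    same : ∀ s → length s ≡ n → does (bitAt (dup s) p ≟ bitAt (dup s) q) ≡ does (bitAt s p' ≟ bitAt s q')
    same s len rewrite bitAt-dup s len hp | bitAt-dup s len hq = refl

  -- in the copies s ∘ s̄ it is the test of s at (p', q') with second-half bits flipped;
  -- R is any test on the bits of s deciding like that flipped test
  agreements-dupc : {T : Bool → Bool → Set} (R : (x y : Bool) → Dec (T x y)) →
                    (∀ x y → does (flipIn hp x ≟ flipIn hq y) ≡ does (R x y)) →
                    agreements p q (map dupc L) ≡ count (λ s → R (bitAt s p') (bitAt s q')) L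
  agreements-dupc R flips = count-map dupc _ _ L (All.map (λ {s} → same s) lens)
    where
    same : ∀ s → length s ≡ n → does (bitAt (dupc s) p ≟ bitAt (dupc s) q) ≡ does (R (bitAt s p') (bitAt s q'))
    same s len rewrite bitAt-dupc s len hp | bitAt-dupc s len hq = flips _ _

  agreements-doubling : agreements p q (doubling L) ≡ agreements p q (map dup L) + agreements p q (map dupc L)
  agreements-doubling = count-interleave dup dupc _ L

  -- p, q in the same half: both kinds of copies contribute A_{p',q'}
  same-half : (∀ x y → does (flipIn hp x ≟ flipIn hq y) ≡ does (x ≟ y)) →
              Balanced p' q' L → Balanced p q (doubling L)
  same-half flips bal = begin
    2 * agreements p q (doubling L) ≡⟨ cong (2 *_) agreements-doubling ⟩
    2 * (agreements p q (map dup L) + agreements p q (map dupc L))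
      ≡⟨ cong (2 *_) (cong₂ _+_ agreements-dup (agreements-dupc _≟_ flips)) ⟩
    2 * (agreements p' q' L + agreements p' q' L) ≡⟨ *-distribˡ-+ 2 (agreements p' q' L) (agreements p' q' L) ⟩
    2 * agreements p' q' L + 2 * agreements p' q' L ≡⟨ cong₂ _+_ bal bal ⟩
    length L + length L                       ≡⟨ sym (length-doubling L) ⟩
    length (doubling L)                       ∎

  -- p, q in different halves: the copies contribute A_{p',q'} + D_{p',q'} = |L|
  cross-half : (∀ x y → does (flipIn hp x ≟ flipIn hq y) ≡ does (¬? (x ≟ y))) →
               Balanced p q (doubling L)
  cross-half flips = begin
    2 * agreements p q (doubling L) ≡⟨ cong (2 *_) agreements-doubling ⟩
    2 * (agreements p q (map dup L) + agreements p q (map dupc L))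
      ≡⟨ cong (2 *_) (cong₂ _+_ agreements-dup (agreements-dupc (λ x y → ¬? (x ≟ y)) flips)) ⟩
    2 * (agreements p' q' L + disagreements p' q' L)
      ≡⟨ cong (2 *_) (count-¬ (λ a → bitAt a p' ≟ bitAt a q') L) ⟩
    2 * length L                              ≡⟨ twice (length L) ⟩
    length L + length L                       ≡⟨ sym (length-doubling L) ⟩
    length (doubling L)                       ∎

doubling-balanced : ∀ {n} L → All (λ s → length s ≡ n) L → ∀ {p q} (hp : Half n p) (hq : Half n q) →
                    p ≢ q → (offset hp ≢ offset hq → Balanced (offset hp) (offset hq) L) →
                    Balanced p q (doubling L)
doubling-balanced L lens hp@(low _)  hq@(low _)  p≢q bal =
  Doubling.same-half L lens hp hq (λ _ _ → refl) (bal p≢q)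
doubling-balanced L lens hp@(high _) hq@(high _) p≢q bal =
  Doubling.same-half L lens hp hq ≟-not-not (bal (p≢q ∘ cong (_ +_)))
doubling-balanced L lens hp@(low _)  hq@(high _) _ _ = Doubling.cross-half L lens hp hq ≟-notʳ
doubling-balanced L lens hp@(high _) hq@(low _)  _ _ = Doubling.cross-half L lens hp hq ≟-notˡ

build-balanced : ∀ k p q → p < 2 ^ suc k → q < 2 ^ suc k → p ≢ q → Balanced p q (build (suc k))
build-balanced zero 0 0 _ _ p≢q = ⊥-elim (p≢q refl)
build-balanced zero 0 1 _ _ _   = refl
build-balanced zero 1 0 _ _ _   = refl
build-balanced zero 1 1 _ _ p≢q = ⊥-elim (p≢q refl)
build-balanced zero (suc (suc p)) q (s≤s (s≤s ())) _ _
build-balanced zero p (suc (suc q)) _ (s≤s (s≤s ())) _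
build-balanced (suc k) p q p< q< p≢q =
  doubling-balanced (build (suc k)) (lengths-build k) hp hq p≢q
    (build-balanced k (offset hp) (offset hq) (offset< hp) (offset< hq))
  where
  hp : Half (2 ^ suc k) p
  hp = half _ p p<
  hq : Half (2 ^ suc k) q
  hq = half _ q q<

proposition1 : (ℓ : ℕ) → 1 ≤ ℓ →
    length (build ℓ) ≡ 2 ^ ℓ
    × All (λ s → length s ≡ 2 ^ ℓ) (build ℓ)
    × ((i j : ℕ) → i < 2 ^ ℓ → j < 2 ^ ℓ → i ≢ j →
        (2 * length (filter (λ a → bitAt a i ≟ bitAt a j) (build ℓ)) ≡ length (build ℓ))
        × (2 * length (filter (λ b → ¬? (bitAt b i ≟ bitAt b j)) (build ℓ)) ≡ length (build ℓ)))
proposition1 (suc k) _ = size-build k , lengths-build k , balanced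
  where
  balanced : ∀ i j → i < 2 ^ suc k → j < 2 ^ suc k → i ≢ j →
             Balanced i j (build (suc k)) × 2 * disagreements i j (build (suc k)) ≡ length (build (suc k))
  balanced i j i< j< i≢j = agree , disagreements-balanced i j (build (suc k)) agree
    where
    agree : Balanced i j (build (suc k))
    agree = build-balanced k i j i< j< i≢j
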